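{- Let $\langle\phi,\vec a\rangle$ be a loop with $\phi(\vec x)\equiv\bigwedge_{i=1}^k C_i$ in CNF, where each clause $C_i$ contains an inequation $e_i(\vec x)>0$ (as one of its disjuncts) such that \[ e_i(\vec x)\ge e_i(\vec a(\vec x))\implies e_i(\vec a(\vec x))\ge e_i(\vec a^2(\vec x)) \] is valid. Then the formula \[ \vec x'=\vec a^n(\vec x)\land\bigwedge_{i=1}^k\bigl(e_i(\vec x)>0\land e_i(\vec a^{n-1}(\vec x))>0\bigr) \] approximates $\langle\phi,\vec a\rangle$. If moreover $C_i\equiv e_i>0$ for all $i\in[1,k]$, then this formula is equivalent to $\langle\phi,\vec a\rangle$.
   Context: Fix $d\ge 1$, integer variables $\vec x=(x_1,\dots,x_d)$, $\vec x'$, and $n$ ranging over $\mathbb N$. A loop $\langle\phi,\vec a\rangle$ consists of a quantifier-free formula $\phi$ over atoms $p>0$ ($p$ an arithmetic expression over $\vec x$, integer semantics) and a map $\vec a:\mathbb Z^d\to\mathbb Z^d$ given by expressions over $\vec x$; $\vec a^m$ is $m$-fold application. $\vec x\longrightarrow_{\langle\phi,\vec a\rangle}\vec x'$ iff $\phi(\vec x)\land\vec x'=\vec a(\vec x)$, and $\longrightarrow^m$ is its $m$-fold composition. A formula $\psi$ over $(\vec x,n,\vec x')$ approximates the loop if for all $\vec x,\vec x'\in\mathbb Z^d$ and $n>0$, $\psi$ implies $\vec x\longrightarrow^n_{\langle\phi,\vec a\rangle}\vec x'$; it is equivalent to the loop if moreover the converse implication holds. Validity means truth for all integer values of the free variables.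 -}

module Defs where

open import Data.Nat using (ℕ; zero; suc)
open import Data.Integer using (ℤ; _+_; _*_; -_; _>_; 0ℤ)
open import Data.Fin using (Fin)
open import Data.Vec using (Vec; lookup; map)
open import Data.List using (List; _∷_; [])
open import Data.List.Relation.Unary.All using (All)
open import Data.List.Relation.Unary.Any using (Any)
open import Data.Product using (Σ; _×_)
open import Relation.Binary.PropositionalEquality using (_≡_)

data Expr (d : ℕ) : Set where
  const : ℤ → Expr d
  var   : Fin d → Expr d
  _⊕_   : Expr d → Expr d → Expr d
  _⊗_   : Expr d → Expr d → Expr d
  ⊖_    : Expr d → Expr d

State : ℕ → Set
State d = Vec ℤ d

eval : ∀ {d} → Expr d → State d → ℤ
eval (const c) x = c
eval (var i)   x = lookup x i
eval (e ⊕ f)   x = eval e x + eval f x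
eval (e ⊗ f)   x = eval e x * eval f x
eval (⊖ e)     x = - eval e x

-- A clause is a disjunction of inequations p > 0 (the list of the p's);
-- a CNF formula is a conjunction of clauses.
Clause : ℕ → Set
Clause d = List (Expr d)

CNF : ℕ → Set
CNF d = List (Clause d)

SatClause : ∀ {d} → Clause d → State d → Set
SatClause C x = Any (λ p → eval p x > 0ℤ) C

SatCNF : ∀ {d} → CNF d → State d → Set
SatCNF φ x = All (λ C → SatClause C x) φ

Update : ℕ → Set
Update d = Vec (Expr d) d

apply : ∀ {d} → Update d → State d → State d
apply a x = map (λ e → eval e x) a

iter : ∀ {d} → Update d → ℕ → State d → State d
iter a zero    x = x
iter a (suc m) x = iter a m (apply a x)

Step : ∀ {d} → CNF d → Update d → State d → State d → Set
Step φ a x x' = SatCNF φ x × x' ≡ apply a x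

Steps : ∀ {d} → CNF d → Update d → ℕ → State d → State d → Set
Steps φ a zero    x x' = x ≡ x'
Steps φ a (suc m) x x' = Σ (State _) (λ y → Step φ a x y × Steps φ a m y x')

{-# OPTIONS --safe #-}
-- Along an orbit x, a x, a² x, … each e_i is a sequence that keeps descending
-- once it has descended.  Such a sequence, if it exceeds a bound at two times,
-- exceeds it at every time in between: before its first descent it is
-- non-decreasing, so it stays above its starting value, and from then on it is
-- non-increasing, so it stays above its final value.  Hence e_i > 0 at the first
-- and last iterate gives e_i > 0, and so C_i, at every iterate, which is exactly
-- an n-step run of the loop.  Conversely, when C_i is e_i > 0, a run of the loop
-- has e_i > 0 at every iterate, in particular at the first and the last.
module Submission where

open import Defs
open import Data.Nat using (ℕ; _∸_; zero; suc; s≤s; z≤n) renaming (_>_ to _>ℕ_; _<_ to _<ℕ_; _≤_ to _≤ℕ_; _+_ to _+ℕ_)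
open import Data.Nat.Properties using (m+[n∸m]≡n; ≤-pred) renaming (≤-refl to ≤ℕ-refl)
open import Data.Integer using (ℤ; _≤_; _<_; _≥_; _>_; 0ℤ; _≤?_)
open import Data.Integer.Properties using (≤-refl; ≤-trans; <-≤-trans; <⇒≤; ≰⇒>)
open import Data.List using (List; map; _∷_; [])
open import Data.List.Relation.Unary.All as All using (All; _∷_; [])
open import Data.List.Relation.Unary.All.Properties using (map⁻)
open import Data.List.Relation.Unary.Any.Properties using (singleton⁻)
open import Data.List.Membership.Propositional using (_∈_; lose)
open import Data.List.Relation.Binary.Pointwise using (Pointwise; _∷_; [])
open import Data.Product using (_×_; _,_)
open import Relation.Binary.PropositionalEquality using (_≡_; refl; sym; subst)
open import Relation.Nullary using (yes; no)

DescentPersists : (ℕ → ℤ) → Set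
DescentPersists s = ∀ k → s (suc k) ≤ s k → s (suc (suc k)) ≤ s (suc k)

descent⇒≤-head : ∀ {s} → DescentPersists s → s 1 ≤ s 0 → ∀ m → s m ≤ s 0
descent⇒≤-head persists drop zero    = ≤-refl
descent⇒≤-head persists drop (suc m) =
  ≤-trans (descent⇒≤-head (λ k → persists (suc k)) (persists 0 drop) m) drop

bounded-below-between : ∀ {s c} j m → DescentPersists s → c < s 0 → c < s (j +ℕ m) → c < s j
bounded-below-between         zero    m persists c<s₀ c<s = c<s₀
bounded-below-between {s} {c} (suc j) m persists c<s₀ c<s =
  bounded-below-between j m (λ k → persists (suc k)) c<s₁ c<s
  where
  c<s₁ : c < s 1
  c<s₁ with s 0 ≤? s 1
  ... | yes rise  = <-≤-trans c<s₀ rise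
  ... | no  s₀≰s₁ = <-≤-trans c<s
    (descent⇒≤-head (λ k → persists (suc k)) (persists 0 (<⇒≤ (≰⇒> s₀≰s₁))) (j +ℕ m))

bounded-below-on-interval : ∀ {s c j m} → j ≤ℕ m → DescentPersists s → c < s 0 → c < s m → c < s j
bounded-below-on-interval {s} {j = j} {m} j≤m persists c<s₀ c<sₘ =
  bounded-below-between j (m ∸ j) persists c<s₀ (subst (λ k → _ < s k) (sym (m+[n∸m]≡n j≤m)) c<sₘ)

module _ {d : ℕ} (a : Update d) where

  DescentPersistsUnder : Expr d → Set
  DescentPersistsUnder e = ∀ x → eval e x ≥ eval e (apply a x) → eval e (apply a x) ≥ eval e (apply a (apply a x))

  iter-suc : ∀ k x → iter a (suc k) x ≡ apply a (iter a k x)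
  iter-suc zero    x = refl
  iter-suc (suc k) x = iter-suc k (apply a x)

  orbit : Expr d → State d → ℕ → ℤ
  orbit e x k = eval e (iter a k x)

  orbit-descentPersists : ∀ {e} → DescentPersistsUnder e → ∀ x → DescentPersists (orbit e x)
  orbit-descentPersists persists x k drop
    rewrite iter-suc (suc k) x | iter-suc k x = persists (iter a k x) drop

module _ {d : ℕ} {φ : CNF d} {a : Update d} where

  guarded-orbit⇒steps : ∀ n x → (∀ j → j <ℕ n → SatCNF φ (iter a j x)) → Steps φ a n x (iter a n x)
  guarded-orbit⇒steps zero    x guards = refl
  guarded-orbit⇒steps (suc n) x guards =
    apply a x , (guards 0 (s≤s z≤n) , refl) , guarded-orbit⇒steps n (apply a x) (λ j j<n → guards (suc j) (s≤s j<n))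

  steps⇒≡iter : ∀ n {x x'} → Steps φ a n x x' → x' ≡ iter a n x
  steps⇒≡iter zero    x≡x'                   = sym x≡x'
  steps⇒≡iter (suc n) (_ , (_ , refl) , run) = steps⇒≡iter n run

  steps⇒guard : ∀ {n x x'} j → j <ℕ n → Steps φ a n x x' → SatCNF φ (iter a j x)
  steps⇒guard zero    (s≤s _)   (_ , (sat , _) , _)    = sat
  steps⇒guard (suc j) (s≤s j<n) (_ , (_ , refl) , run) = steps⇒guard j j<n run

module _ {d : ℕ} (x : State d) where

  Positive : Expr d → Set
  Positive e = eval e x > 0ℤ

  witnesses⇒SatCNF : ∀ {es φ} → Pointwise (λ e C → e ∈ C) es φ → All Positive es → SatCNF φ x
  witnesses⇒SatCNF []           []           = []
  witnesses⇒SatCNF (e∈C ∷ e∈Cs) (pos ∷ poss) = lose e∈C pos ∷ witnesses⇒SatCNF e∈Cs poss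

  unitCNF⇒positive : ∀ es → SatCNF (map (λ e → e ∷ []) es) x → All Positive es
  unitCNF⇒positive es sat = All.map singleton⁻ (map⁻ sat)

module _ {d : ℕ} {φ : CNF d} {a : Update d} {es : List (Expr d)} where

  PositiveAtEnds : State d → ℕ → Set
  PositiveAtEnds x m = All (λ e → Positive x e × Positive (iter a m x) e) es

  positiveAtEnds⇒steps : Pointwise (λ e C → e ∈ C) es φ → All (DescentPersistsUnder a) es
                       → ∀ x m → PositiveAtEnds x m → Steps φ a (suc m) x (iter a (suc m) x)
  positiveAtEnds⇒steps e∈Cs persists x m ends = guarded-orbit⇒steps (suc m) x guard
    where
    guard : ∀ j → j <ℕ suc m → SatCNF φ (iter a j x)
    guard j j<n = witnesses⇒SatCNF (iter a j x) e∈Cs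
      (All.zipWith (λ {e} (persistsₑ , pos₀ , posₘ) →
          bounded-below-on-interval (≤-pred j<n) (orbit-descentPersists a {e} persistsₑ x) pos₀ posₘ)
        (persists , ends))

  unitSteps⇒positiveAtEnds : φ ≡ map (λ e → e ∷ []) es → ∀ {x x'} m → Steps φ a (suc m) x x' → PositiveAtEnds x m
  unitSteps⇒positiveAtEnds refl {x} m run =
    All.zip (unitCNF⇒positive x es (steps⇒guard 0 (s≤s z≤n) run)
           , unitCNF⇒positive (iter a m x) es (steps⇒guard m ≤ℕ-refl run))

theorem10 : {d : ℕ} (φ : CNF d) (a : Update d) (es : List (Expr d))
    → Pointwise (λ e C → e ∈ C) es φ
    → All (λ e → (x : State d)
          → eval e x ≥ eval e (apply a x)
          → eval e (apply a x) ≥ eval e (apply a (apply a x))) es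
    → ((x x' : State d) (n : ℕ) → n >ℕ 0
         → x' ≡ iter a n x
           × All (λ e → eval e x > 0ℤ × eval e (iter a (n ∸ 1) x) > 0ℤ) es
         → Steps φ a n x x')
      × (φ ≡ map (λ e → e ∷ []) es
         → (x x' : State d) (n : ℕ) → n >ℕ 0
         → Steps φ a n x x'
         → x' ≡ iter a n x
           × All (λ e → eval e x > 0ℤ × eval e (iter a (n ∸ 1) x) > 0ℤ) es)
theorem10 φ a es e∈Cs persists =
  (λ { x _ (suc m) _ (refl , ends) → positiveAtEnds⇒steps e∈Cs persists x m ends })
  , λ { unit x _ (suc m) _ run → steps⇒≡iter (suc m) run , unitSteps⇒positiveAtEnds unit m run }
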